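{- Let $\mathbb A$ be a first-order expansion of a $k$-homogeneous $\ell$-bounded model-complete core, let $\mathcal I=(\mathcal V,\mathcal C)$ be an instance of $\mathrm{CSP}(\mathbb A)$, and let $\mathcal I_{\max}=(\mathcal V,\mathcal C_{\max})$ where $\mathcal C_{\max}$ consists of $\mathcal C$ together with the constraints $A^U$ for all $\max(k,\ell)$-element subsets $U\subseteq\mathcal V$. Let $(D_T)_T$ be the family returned by Algorithm 2 (described in the context). Let $\mathcal I'_{\max}=(\mathcal V,\mathcal C'_{\max})$ be obtained from $\mathcal I_{\max}$ by replacing each $C\in\mathcal C_{\max}$ with scope $U$ by $C'=\{f\in C: f|_Z\in D_Z\text{ for all }Z\subseteq U\text{ with }1\le|Z|\le k\}$. Then $\mathcal I'_{\max}$ is $(k,\max(k,\ell))$-minimal and has the same set of solutions as $\mathcal I$.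
   Context: $k$-homogeneous: tuples of equal finite length whose corresponding subtuples of length at most $k$ lie in the same $\mathrm{Aut}$-orbits lie in the same orbit. $\ell$-bounded: every finite structure all of whose substructures with at most $\ell$ elements embed into the structure embeds into it. Model-complete core: every endomorphism agrees on each finite set with an automorphism. First-order expansion: expansion by first-order definable relations. Instances: $(\mathcal V,\mathcal C)$ with constraints $C\subseteq A^U$ (nonempty scope $U$) represented by relations of $\mathbb A$; a solution is $f:\mathcal V\to A$ with $f|_U\in C$ for all constraints. $(k,m)$-minimal ($k\le m$): every set of at most $m$ variables lies in the scope of some constraint, and for every tuple $\bar u$ of at most $k$ variables, all constraints whose scope contains its entries have the same projection $\{f|_{S(\bar u)}:f\in C\}$. Algorithm 2 on $\mathcal I_{\max}$: Step 1: for every $T\subseteq\mathcal V$ with $1\le|T|\le k$ set $D_T:=A^T$. Step 2 (loop): for $C\in\mathcal C_{\max}$ with scope $U$ and $T\subseteq U$ with $1\le|T|\le k$ let $\widehat{D_T}=\{g|_T: g\in C,\ g|_Z\in D_Z\text{ for all }Z\subseteq U,\ 1\le|Z|\le k\}$. If $D_T\subseteq\widehat{D_T}$ for all such pairs $(C,T)$, stop; otherwise for some pair with $D_T\not\subseteq\widehat{D_T}$ set $D_T:=D_T\cap\widehat{D_T}$ and repeat. Step 3: return $(D_T)_T$. -}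

module Defs where

open import Data.Nat using (ℕ; zero; suc; _≤_)
open import Data.Fin using (Fin; _≟_)
open import Data.Fin.Subset using (Subset; _∈_; _⊆_; ∣_∣; Nonempty)
open import Data.Fin.Properties using (any?)
open import Data.Vec using (tabulate)
open import Relation.Nullary using (¬_; does)
open import Data.Product using (Σ; _×_; _,_; proj₁; proj₂)
open import Data.Sum using (_⊎_; inj₁; inj₂; [_,_])
open import Data.Unit using (⊤)
open import Data.Empty using (⊥)
open import Data.List using (List)
open import Data.List.Membership.Propositional using () renaming (_∈_ to _∈L_)
open import Data.List.Relation.Unary.All using (All)
open import Function using (_∘_)
open import Function.Bundles using (_⇔_)
open import Function.Definitions using (Injective)
open import Relation.Binary.PropositionalEquality using (_≡_; _≢_)
open import Relation.Binary.Construct.Closure.ReflexiveTransitive using (Star)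

record Signature : Set₁ where
  field
    Sym : Set
    ar  : Sym → ℕ
open Signature public

Tuple : Set → ℕ → Set
Tuple A m = Fin m → A

Rels : Signature → Set → Set₁
Rels σ A = (s : Sym σ) → Tuple A (ar σ s) → Set

record Structure (σ : Signature) : Set₁ where
  field
    Carrier : Set
    rel     : Rels σ Carrier
open Structure public

module _ {σ : Signature} (B : Structure σ) where

  record Automorphism : Set where
    field
      fun   : Carrier B → Carrier B
      inv   : Carrier B → Carrier B
      inv-r : ∀ x → fun (inv x) ≡ x
      inv-l : ∀ x → inv (fun x) ≡ x
      pres  : ∀ s (t : Tuple (Carrier B) (ar σ s)) → rel B s t ⇔ rel B s (fun ∘ t)

  record Endomorphism : Set where
    field
      fun  : Carrier B → Carrier B
      pres : ∀ s (t : Tuple (Carrier B) (ar σ s)) → rel B s t → rel B s (fun ∘ t)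

  SameOrbit : ∀ {m} → Tuple (Carrier B) m → Tuple (Carrier B) m → Set
  SameOrbit a b = Σ Automorphism λ α → ∀ i → Automorphism.fun α (a i) ≡ b i

  Homogeneous : ℕ → Set
  Homogeneous k = ∀ m (a b : Tuple (Carrier B) m) →
    (∀ r (ι : Fin r → Fin m) → Injective _≡_ _≡_ ι → r ≤ k → SameOrbit (a ∘ ι) (b ∘ ι)) →
    SameOrbit a b

  Embeds : {C : Set} → Rels σ C → Set
  Embeds {C} R = Σ (C → Carrier B) λ f →
    Injective _≡_ _≡_ f × (∀ s (t : Tuple C (ar σ s)) → R s t ⇔ rel B s (f ∘ t))

  Bounded : ℕ → Set₁
  Bounded ℓ = ∀ p (R : Rels σ (Fin p)) →
    (∀ r (ι : Fin r → Fin p) → Injective _≡_ _≡_ ι → r ≤ ℓ →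
       Embeds {Fin r} (λ s t → R s (ι ∘ t))) →
    Embeds R

  ModelCompleteCore : Set
  ModelCompleteCore = ∀ (e : Endomorphism) (xs : List (Carrier B)) →
    Σ Automorphism λ α →
      All (λ x → Endomorphism.fun e x ≡ Automorphism.fun α x) xs

data Formula (σ : Signature) : ℕ → Set where
  atom   : ∀ {n} (s : Sym σ) → (Fin (ar σ s) → Fin n) → Formula σ n
  equal  : ∀ {n} → Fin n → Fin n → Formula σ n
  falsum : ∀ {n} → Formula σ n
  neg    : ∀ {n} → Formula σ n → Formula σ n
  conj   : ∀ {n} → Formula σ n → Formula σ n → Formula σ n
  disj   : ∀ {n} → Formula σ n → Formula σ n → Formula σ n
  exs    : ∀ {n} → Formula σ (suc n) → Formula σ n
  all    : ∀ {n} → Formula σ (suc n) → Formula σ n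

extend : ∀ {A : Set} {n} → A → (Fin n → A) → Fin (suc n) → A
extend a env Fin.zero    = a
extend a env (Fin.suc i) = env i

Sat : ∀ {σ} (B : Structure σ) {n} → Formula σ n → (Fin n → Carrier B) → Set
Sat B (atom s v)  env = rel B s (env ∘ v)
Sat B (equal i j) env = env i ≡ env j
Sat B falsum      env = ⊥
Sat B (neg φ)     env = ¬ Sat B φ env
Sat B (conj φ ψ)  env = Sat B φ env × Sat B ψ env
Sat B (disj φ ψ)  env = Sat B φ env ⊎ Sat B ψ env
Sat B (exs φ)     env = Σ (Carrier B) λ a → Sat B φ (extend a env)
Sat B (all φ)     env = (a : Carrier B) → Sat B φ (extend a env)

expSig : Signature → (E : Set) → (E → ℕ) → Signature
expSig σ E arE = record { Sym = Sym σ ⊎ E ; ar = [ ar σ , arE ] }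

expRel : ∀ {σ} (B : Structure σ) (E : Set) (arE : E → ℕ)
         (φ : (e : E) → Formula σ (arE e)) → Rels (expSig σ E arE) (Carrier B)
expRel B E arE φ (inj₁ s) t = rel B s t
expRel B E arE φ (inj₂ e) t = Sat B (φ e) t

FOExpansion : ∀ {σ} (B : Structure σ) (E : Set) (arE : E → ℕ)
              (φ : (e : E) → Formula σ (arE e)) → Structure (expSig σ E arE)
FOExpansion B E arE φ = record { Carrier = Carrier B ; rel = expRel B E arE φ }

Assign : Set → ∀ {n} → Subset n → Set
Assign A {n} U = (i : Fin n) → i ∈ U → A

-- equality of assignments (independent of membership proofs)
_≈ₐ_ : ∀ {A n} {U : Subset n} → Assign A U → Assign A U → Set
f ≈ₐ g = ∀ i p q → f i p ≡ g i q

restrict : ∀ {A n} {Z U : Subset n} → Z ⊆ U → Assign A U → Assign A Z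
restrict z f i p = f i (z p)

total : ∀ {A n} {U : Subset n} → (Fin n → A) → Assign A U
total f i _ = f i

entries : ∀ {n r} → (Fin r → Fin n) → Subset n
entries {r = r} u = tabulate (λ i → does (any? (λ j → u j ≟ i)))

record GInstance (A : Set) (n : ℕ) : Set₁ where
  field
    Idx   : Set
    scope : Idx → Subset n
    con   : (c : Idx) → Assign A (scope c) → Set
open GInstance public

Solution : ∀ {A n} → GInstance A n → (Fin n → A) → Set
Solution I f = ∀ c → con I c (total f)

-- a constraint of CSP(𝔸) given by a relation symbol s and a tuple ū of variables:
-- scope = entries of ū,  C = { g : (g(u₁),…,g(uᵣ)) ∈ s^𝔸 }
RConstraint : Signature → ℕ → Set
RConstraint σ n = Σ (Sym σ) λ s → Fin (ar σ s) → Fin n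

rcon : ∀ {σ n} (𝔸 : Structure σ) (c : RConstraint σ n) →
       Assign (Carrier 𝔸) (entries (proj₂ c)) → Set
rcon {σ} 𝔸 (s , u) g = Σ (Tuple (Carrier 𝔸) (ar σ s)) λ a →
  rel 𝔸 s a × (∀ j p → g (u j) p ≡ a j)

WellFormed : ∀ {σ n} → List (RConstraint σ n) → Set
WellFormed cs = All (λ c → Nonempty (entries (proj₂ c))) cs

Inst : ∀ {σ n} (𝔸 : Structure σ) → List (RConstraint σ n) → GInstance (Carrier 𝔸) n
Inst {σ} {n} 𝔸 cs = record
  { Idx = Σ (RConstraint σ n) (_∈L cs)
  ; scope = λ c → entries (proj₂ (proj₁ c))
  ; con = λ c → rcon 𝔸 (proj₁ c) }

-- 𝓘_max: add the full constraints A^U for nonempty U with |U| ≤ m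
BigSet : ℕ → ℕ → Set
BigSet n m = Σ (Subset n) λ U → Nonempty U × ∣ U ∣ ≤ m

Imax : ∀ {σ n} (𝔸 : Structure σ) → List (RConstraint σ n) → ℕ → GInstance (Carrier 𝔸) n
Imax {σ} {n} 𝔸 cs m = record
  { Idx = Idx (Inst 𝔸 cs) ⊎ BigSet n m
  ; scope = [ scope (Inst 𝔸 cs) , proj₁ ]
  ; con = λ { (inj₁ c) → con (Inst 𝔸 cs) c ; (inj₂ U) → λ _ → ⊤ } }

Dom : Set → ℕ → Set₁
Dom A n = (T : Subset n) → Assign A T → Set

D₀ : ∀ {A n} → Dom A n
D₀ T h = ⊤

Ok : ∀ {A n} → ℕ → Dom A n → {U : Subset n} → Assign A U → Set
Ok k D {U} g = ∀ Z (z : Z ⊆ U) → 1 ≤ ∣ Z ∣ → ∣ Z ∣ ≤ k → D Z (restrict z g)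

hat : ∀ {A n} (I : GInstance A n) (k : ℕ) (D : Dom A n) (c : Idx I)
      (T : Subset n) → T ⊆ scope I c → Assign A T → Set
hat {A} I k D c T t h = Σ (Assign A (scope I c)) λ g →
  con I c g × Ok k D g × (restrict t g ≈ₐ h)

Stable : ∀ {A n} → GInstance A n → ℕ → Dom A n → Set
Stable I k D = ∀ c T (t : T ⊆ scope I c) → 1 ≤ ∣ T ∣ → ∣ T ∣ ≤ k →
  ∀ h → D T h → hat I k D c T t h

-- one iteration of the loop (some violating pair (C,T) is chosen)
Step : ∀ {A n} → GInstance A n → ℕ → Dom A n → Dom A n → Set
Step I k D D' = Σ (Idx I) λ c → Σ _ λ T → Σ (T ⊆ scope I c) λ t →
  1 ≤ ∣ T ∣ × ∣ T ∣ ≤ k ×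
  ¬ (∀ h → D T h → hat I k D c T t h) ×
  (∀ h → D' T h ⇔ (D T h × hat I k D c T t h)) ×
  (∀ Z → Z ≢ T → ∀ h → D' Z h ⇔ D Z h)

-- D is a family returned by (some terminating run of) Algorithm 2
Returned : ∀ {A n} → GInstance A n → ℕ → Dom A n → Set₁
Returned I k D = Star (Step I k) D₀ D × Stable I k D

Restricted : ∀ {A n} → GInstance A n → ℕ → Dom A n → GInstance A n
Restricted I k D = record
  { Idx = Idx I ; scope = scope I ; con = λ c g → con I c g × Ok k D g }

proj : ∀ {A n} (I : GInstance A n) (c : Idx I) {S : Subset n} →
       S ⊆ scope I c → Assign A S → Set
proj {A} I c p h = Σ (Assign A (scope I c)) λ g → con I c g × (restrict p g ≈ₐ h)

Minimal : ∀ {A n} → ℕ → ℕ → GInstance A n → Set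
Minimal {A} {n} k m I =
  (∀ (S : Subset n) → Nonempty S → ∣ S ∣ ≤ m → Σ (Idx I) λ c → S ⊆ scope I c) ×
  (∀ r (u : Fin r → Fin n) → 1 ≤ r → r ≤ k →
     ∀ c c' (p : entries u ⊆ scope I c) (p' : entries u ⊆ scope I c') →
     ∀ h → proj I c p h ⇔ proj I c' p' h)

{-# OPTIONS --safe #-}
module Submission where

-- None of the hypotheses on B is needed (nor is WellFormed): they guarantee that
-- Algorithm 2 terminates, and Returned already provides a terminating run.
--
-- Minimality: if h is the projection to T (1 ≤ |T| ≤ k) of some g ∈ C', then
-- g|_T ∈ D_T, so stability of D extends g|_T, and hence h, to an element of E'
-- for every other constraint E whose scope contains T. Covering all sets of at
-- most max(k,ℓ) variables is already built into 𝓘_max.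
--
-- Solutions: a solution f of 𝓘 satisfies every full constraint A^U, and every
-- step of the algorithm keeps f|_T ∈ D_T, because f itself witnesses
-- f|_T ∈ \widehat{D_T}. Hence f satisfies all the restricted constraints C'.

open import Defs
open import Data.Nat using (ℕ; _⊔_; zero; suc; _≤_; _+_; z≤n; s≤s)
open import Data.Nat.Properties using (+-suc; m≤n⇒m≤1+n; ≤-trans; module ≤-Reasoning)
open import Data.Fin using (Fin)
open import Data.Fin.Subset using (Subset; _∈_; _⊆_; ∣_∣; Nonempty; _∪_; ⁅_⁆; ⊥; inside; outside)
open import Data.Fin.Subset.Properties
  using (p⊆q⇒∣p∣≤∣q∣; ∣⊥∣≡0; ∣⁅x⁆∣≡1; x∈⁅x⁆; x∈⁅y⁆⇒x≡y; x∈p∪q⁺)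
open import Data.Fin.Properties using (any?)
import Data.Fin as Fin
import Data.Bool as Bool
open import Data.Vec using ([]; _∷_; lookup)
open import Data.Vec.Properties using ([]=⇒lookup; lookup⇒[]=; lookup∘tabulate; ≡-dec)
open import Data.Product using (_×_; _,_; proj₁; ∃)
open import Data.Sum using (inj₁; inj₂)
open import Data.Unit using (tt)
open import Data.List using (List)
open import Function using (_∘_; case_of_)
open import Function.Bundles using (_⇔_; mk⇔; Equivalence)
open import Function.Properties.Equivalence using () renaming (trans to ⇔-trans)
open import Relation.Nullary using (yes; no; does)
open import Relation.Nullary.Decidable using (dec-true)
open import Relation.Binary.Definitions using (_Respects_)
open import Relation.Binary.PropositionalEquality using (_≡_; refl; sym; trans; subst; cong)
open import Relation.Binary.Construct.Closure.ReflexiveTransitive using (Star; ε; _◅_)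

open Equivalence using (from)

∣p∪q∣≤∣p∣+∣q∣ : ∀ {n} (p q : Subset n) → ∣ p ∪ q ∣ ≤ ∣ p ∣ + ∣ q ∣
∣p∪q∣≤∣p∣+∣q∣ []            []            = z≤n
∣p∪q∣≤∣p∣+∣q∣ (outside ∷ p) (outside ∷ q) = ∣p∪q∣≤∣p∣+∣q∣ p q
∣p∪q∣≤∣p∣+∣q∣ (inside  ∷ p) (outside ∷ q) = s≤s (∣p∪q∣≤∣p∣+∣q∣ p q)
∣p∪q∣≤∣p∣+∣q∣ (outside ∷ p) (inside  ∷ q) rewrite +-suc ∣ p ∣ ∣ q ∣ =
  s≤s (∣p∪q∣≤∣p∣+∣q∣ p q)
∣p∪q∣≤∣p∣+∣q∣ (inside  ∷ p) (inside  ∷ q) rewrite +-suc ∣ p ∣ ∣ q ∣ =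
  s≤s (m≤n⇒m≤1+n (∣p∪q∣≤∣p∣+∣q∣ p q))

module _ {n r : ℕ} (u : Fin r → Fin n) where

  private
    lookup-entries : ∀ i → lookup (entries u) i ≡ does (any? (λ j → u j Fin.≟ i))
    lookup-entries = lookup∘tabulate (λ i → does (any? (λ j → u j Fin.≟ i)))

  ∈-entries⁺ : ∀ j → u j ∈ entries u
  ∈-entries⁺ j = lookup⇒[]= (u j) (entries u)
    (trans (lookup-entries (u j)) (dec-true (any? (λ j′ → u j′ Fin.≟ u j)) (j , refl)))

  ∈-entries⁻ : ∀ {i} → i ∈ entries u → ∃ λ j → u j ≡ i
  ∈-entries⁻ {i} i∈u
    with any? (λ j → u j Fin.≟ i) | trans (sym (lookup-entries i)) ([]=⇒lookup i∈u)
  ... | yes ∃j | _ = ∃j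
  ... | no  _  | ()

entries-⊆ : ∀ {n r} (u : Fin (suc r) → Fin n) →
            entries u ⊆ ⁅ u Fin.zero ⁆ ∪ entries (u ∘ Fin.suc)
entries-⊆ u x∈u with ∈-entries⁻ u x∈u
... | Fin.zero  , refl = x∈p∪q⁺ (inj₁ (x∈⁅x⁆ _))
... | Fin.suc j , refl = x∈p∪q⁺ (inj₂ (∈-entries⁺ (u ∘ Fin.suc) j))

∣entries∣≤ : ∀ {n r} (u : Fin r → Fin n) → ∣ entries u ∣ ≤ r
∣entries∣≤ {n} {zero} u = subst (∣ entries u ∣ ≤_) (∣⊥∣≡0 n)
  (p⊆q⇒∣p∣≤∣q∣ {q = ⊥} λ x∈u → case ∈-entries⁻ u x∈u of λ ())
∣entries∣≤ {r = suc r} u = begin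
  ∣ entries u ∣
    ≤⟨ p⊆q⇒∣p∣≤∣q∣ (entries-⊆ u) ⟩
  ∣ ⁅ u₀ ⁆ ∪ entries u₊ ∣
    ≤⟨ ∣p∪q∣≤∣p∣+∣q∣ ⁅ u₀ ⁆ (entries u₊) ⟩
  ∣ ⁅ u₀ ⁆ ∣ + ∣ entries u₊ ∣
    ≡⟨ cong (_+ ∣ entries u₊ ∣) (∣⁅x⁆∣≡1 u₀) ⟩
  suc ∣ entries u₊ ∣
    ≤⟨ s≤s (∣entries∣≤ u₊) ⟩
  suc r ∎
  where
  open ≤-Reasoning
  u₀ : Fin _
  u₀ = u Fin.zero
  u₊ : Fin r → Fin _
  u₊ = u ∘ Fin.suc

1≤∣entries∣ : ∀ {n r} (u : Fin (suc r) → Fin n) → 1 ≤ ∣ entries u ∣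
1≤∣entries∣ u = begin
  1                  ≡⟨ sym (∣⁅x⁆∣≡1 (u Fin.zero)) ⟩
  ∣ ⁅ u Fin.zero ⁆ ∣ ≤⟨ p⊆q⇒∣p∣≤∣q∣ ⁅u₀⁆⊆u ⟩
  ∣ entries u ∣      ∎
  where
  open ≤-Reasoning
  ⁅u₀⁆⊆u : ⁅ u Fin.zero ⁆ ⊆ entries u
  ⁅u₀⁆⊆u x∈⁅u₀⁆ = subst (_∈ entries u) (sym (x∈⁅y⁆⇒x≡y _ x∈⁅u₀⁆)) (∈-entries⁺ u Fin.zero)

module _ {A : Set} {n : ℕ} (I : GInstance A n) (k : ℕ) where

  proj-Restricted-transfer : ∀ {D} → Stable I k D →
    ∀ {T} c c′ (t : T ⊆ scope I c) (t′ : T ⊆ scope I c′) → 1 ≤ ∣ T ∣ → ∣ T ∣ ≤ k →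
    ∀ h → proj (Restricted I k D) c t h → proj (Restricted I k D) c′ t′ h
  proj-Restricted-transfer stable {T} c c′ t t′ 1≤∣T∣ ∣T∣≤k h (g , (g∈C , g-ok) , g|T≈h)
    with stable c′ T t′ 1≤∣T∣ ∣T∣≤k (restrict t g) (g-ok T t 1≤∣T∣ ∣T∣≤k)
  ... | g′ , g′∈C′ , g′-ok , g′|T≈g|T =
    g′ , (g′∈C′ , g′-ok) , λ i p q → trans (g′|T≈g|T i p p) (g|T≈h i p q)

  Restricted-minimal : ∀ {D} m →
    (∀ S → Nonempty S → ∣ S ∣ ≤ m → ∃ λ c → S ⊆ scope I c) →
    Stable I k D → Minimal k m (Restricted I k D)
  Restricted-minimal m covers stable = covers , λ where
    (suc r) u (s≤s z≤n) r≤k c c′ p p′ h →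
      let 1≤∣u∣ = 1≤∣entries∣ u
          ∣u∣≤k = ≤-trans (∣entries∣≤ u) r≤k
      in mk⇔ (proj-Restricted-transfer stable c c′ p p′ 1≤∣u∣ ∣u∣≤k h)
             (proj-Restricted-transfer stable c′ c p′ p 1≤∣u∣ ∣u∣≤k h)

  Admits : (Fin n → A) → Dom A n → Set
  Admits f D = ∀ Z → 1 ≤ ∣ Z ∣ → ∣ Z ∣ ≤ k → D Z (total f)

  module _ {f : Fin n → A} (f-sol : Solution I f) where

    Step-preserves-Admits : Admits f Respects Step I k
    Step-preserves-Admits (c , T , t , 1≤∣T∣ , ∣T∣≤k , _ , D′T⇔ , D′Z⇔) f-ok Z 1≤∣Z∣ ∣Z∣≤k
      with ≡-dec Bool._≟_ Z T
    ... | yes refl = from (D′T⇔ (total f))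
      (f-ok T 1≤∣T∣ ∣T∣≤k , total f , f-sol c , (λ Z′ _ → f-ok Z′) , λ _ _ _ → refl)
    ... | no Z≢T = from (D′Z⇔ Z Z≢T (total f)) (f-ok Z 1≤∣Z∣ ∣Z∣≤k)

    Run-preserves-Admits : Admits f Respects Star (Step I k)
    Run-preserves-Admits ε              = λ f-ok → f-ok
    Run-preserves-Admits (step ◅ steps) =
      Run-preserves-Admits steps ∘ Step-preserves-Admits step

  Solution-Restricted⇔ : ∀ {D} → Star (Step I k) D₀ D →
    ∀ f → Solution (Restricted I k D) f ⇔ Solution I f
  Solution-Restricted⇔ run f = mk⇔ (λ f-sol′ c → proj₁ (f-sol′ c)) λ f-sol c →
    f-sol c , λ Z _ → Run-preserves-Admits f-sol run (λ _ _ _ → tt) Z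

module _ {σ : Signature} (𝔸 : Structure σ) {n : ℕ} (cs : List (RConstraint σ n)) (m : ℕ) where

  Imax-covers : ∀ S → Nonempty S → ∣ S ∣ ≤ m → ∃ λ c → S ⊆ scope (Imax 𝔸 cs m) c
  Imax-covers S S≢∅ ∣S∣≤m = inj₂ (S , S≢∅ , ∣S∣≤m) , λ x∈S → x∈S

  Solution-Imax⇔ : ∀ f → Solution (Imax 𝔸 cs m) f ⇔ Solution (Inst 𝔸 cs) f
  Solution-Imax⇔ f = mk⇔ (λ f-sol c → f-sol (inj₁ c)) λ where
    f-sol (inj₁ c) → f-sol c
    f-sol (inj₂ _) → tt

proposition4p10 : (σ : Signature) (B : Structure σ) (k ℓ : ℕ) →
    Homogeneous B k → Bounded B ℓ → ModelCompleteCore B →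
    (E : Set) (arE : E → ℕ) (φ : (e : E) → Formula σ (arE e)) →
    (n : ℕ) (cs : List (RConstraint (expSig σ E arE) n)) → WellFormed cs →
    (D : Dom (Carrier B) n) →
    Returned (Imax (FOExpansion B E arE φ) cs (k ⊔ ℓ)) k D →
    Minimal k (k ⊔ ℓ) (Restricted (Imax (FOExpansion B E arE φ) cs (k ⊔ ℓ)) k D) ×
    (∀ (f : Fin n → Carrier B) →
       Solution (Restricted (Imax (FOExpansion B E arE φ) cs (k ⊔ ℓ)) k D) f ⇔
       Solution (Inst (FOExpansion B E arE φ) cs) f)
proposition4p10 σ B k ℓ _ _ _ E arE φ n cs _ D (run , stable) =
  Restricted-minimal I k (k ⊔ ℓ) (Imax-covers 𝔸 cs (k ⊔ ℓ)) stable ,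
  λ f → ⇔-trans (Solution-Restricted⇔ I k run f) (Solution-Imax⇔ 𝔸 cs (k ⊔ ℓ) f)
  where
  𝔸 : Structure (expSig σ E arE)
  𝔸 = FOExpansion B E arE φ
  I : GInstance (Carrier B) n
  I = Imax 𝔸 cs (k ⊔ ℓ)
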